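{- The canonical model $\langle \mathsf{Fma}, \leq, \mathbb{I}, \mathbb{L}, \mathbb{R}, v\rangle$ of $\mathtt{SkMBiCA}$ is a $\mathtt{SkMBiCA}$ model, where $\mathsf{Fma}$ is the set of all formulae, $A\le B$ iff $A\vdash_{\mathsf{L}} B$ is derivable, $v(A) = \{B : B\vdash_{\mathsf{L}} A \text{ is derivable}\}$, $\mathbb{I}=v(\mathsf{I})$, $\mathbb{L}ABC$ iff $C \vdash_{\mathsf{L}} A\otimes^{\mathsf{L}} B$ is derivable, and $\mathbb{R}ABC$ iff $C \vdash_{\mathsf{L}} A\otimes^{\mathsf{R}} B$ is derivable.
   Context: Formulae are generated by $A,B ::= X \mid \mathsf{I} \mid A \otimes^{\mathsf{L}} B \mid A \multimap^{\mathsf{L}} B \mid A \otimes^{\mathsf{R}} B \mid A \multimap^{\mathsf{R}} B$, with $X$ ranging over a set of atoms. $\mathtt{SkMBiCA}$ has sequents $A \vdash_{\mathsf{L}} B$ generated by: (id) $A\vdash_{\mathsf{L}} A$; (comp) from $A \vdash_{\mathsf{L}} B$ and $B \vdash_{\mathsf{L}} C$ infer $A \vdash_{\mathsf{L}} C$; ($\otimes^{\mathsf{L}}$) from $A\vdash_{\mathsf{L}} C$, $B \vdash_{\mathsf{L}} D$ infer $A\otimes^{\mathsf{L}} B \vdash_{\mathsf{L}} C \otimes^{\mathsf{L}} D$; ($\multimap^{\mathsf{L}}$) from $C \vdash_{\mathsf{L}} A$, $B \vdash_{\mathsf{L}} D$ infer $A\multimap^{\mathsf{L}} B \vdash_{\mathsf{L}}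 C\multimap^{\mathsf{L}} D$; ($\multimap^{\mathsf{R}}$) from $C \vdash_{\mathsf{L}} A$, $B \vdash_{\mathsf{L}} D$ infer $A\multimap^{\mathsf{R}} B \vdash_{\mathsf{L}} C\multimap^{\mathsf{R}} D$; axioms ($\lambda$) $\mathsf{I}\otimes^{\mathsf{L}} A \vdash_{\mathsf{L}} A$, ($\rho$) $A \vdash_{\mathsf{L}} A \otimes^{\mathsf{L}} \mathsf{I}$, ($\alpha$) $(A\otimes^{\mathsf{L}} B)\otimes^{\mathsf{L}} C \vdash_{\mathsf{L}} A \otimes^{\mathsf{L}}(B\otimes^{\mathsf{L}} C)$, ($\gamma$) $A \otimes^{\mathsf{L}} B \vdash_{\mathsf{L}} B \otimes^{\mathsf{R}} A$, ($\gamma^{ -1}$) $A \otimes^{\mathsf{R}} B \vdash_{\mathsf{L}} B \otimes^{\mathsf{L}} A$; bidirectional rules ($\pi$) $A \vdash_{\mathsf{L}} B \multimap^{\mathsf{L}} C$ iff $A \otimes^{\mathsf{L}} B \vdash_{\mathsf{L}} C$, ($\pi^{\mathsf{R}}$) $A \vdash_{\mathsf{L}} B \multimap^{\mathsf{R}} C$ iff $A \otimes^{\mathsf{R}} B \vdash_{\mathsf{L}} C$. A $\mathtt{SkMBiCA}$ frame is $\langle W,\leq,\mathbb{I},\mathbb{L},\mathbb{R}\rangle$ with $W$ a set, $\le$ a preorder, $\mathbb{I}\subseteq W$ downward closed, $\mathbb{L},\mathbb{R}\subseteq W^3$ upward closed in their first two arguments and downward closed in their third, satisfying: ($\mathbb{LR}$-reverse)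 $\mathbb{L}abc \iff \mathbb{R}bac$; (LSA) if $\mathbb{L}abx$ and $\mathbb{L}xcd$ then there is $y$ with $\mathbb{L}bcy$ and $\mathbb{L}ayd$; (LSLU) for $a,b\in W$, $e\in\mathbb{I}$, $\mathbb{L}eab$ implies $b\le a$; (LSRU) for every $a$ there is $e\in\mathbb{I}$ with $\mathbb{L}aea$. A valuation is a map $v$ from formulae to downward closed subsets of $W$ with $v(\mathsf{I})=\mathbb{I}$, $v(A\otimes^{\mathsf{L}} B) = \{c : \exists a\in v(A), b\in v(B), \mathbb{L}abc\}$, $v(A\multimap^{\mathsf{L}} B)=\{c : \forall a\in v(A), b\in W, \mathbb{L}cab \Rightarrow b\in v(B)\}$, and analogously for $\otimes^{\mathsf{R}},\multimap^{\mathsf{R}}$ with $\mathbb{R}$. A $\mathtt{SkMBiCA}$ model is a $\mathtt{SkMBiCA}$ frame with a valuation. -}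

module Defs where

open import Data.Product using (Σ; ∃; _×_; _,_)
open import Function.Bundles using (_⇔_)

data Fma (At : Set) : Set where
  at   : At → Fma At
  I    : Fma At
  _⊗L_ : Fma At → Fma At → Fma At
  _⊸L_ : Fma At → Fma At → Fma At
  _⊗R_ : Fma At → Fma At → Fma At
  _⊸R_ : Fma At → Fma At → Fma At

infixr 30 _⊗L_ _⊗R_
infixr 25 _⊸L_ _⊸R_

infix 15 _⊢L_

data _⊢L_ {At : Set} : Fma At → Fma At → Set where
  id    : ∀ {A} → A ⊢L A
  comp  : ∀ {A B C} → A ⊢L B → B ⊢L C → A ⊢L C
  ⊗L-r  : ∀ {A B C D} → A ⊢L C → B ⊢L D → A ⊗L B ⊢L C ⊗L D
  ⊸L-r  : ∀ {A B C D} → C ⊢L A → B ⊢L D → A ⊸L B ⊢L C ⊸L D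
  ⊸R-r  : ∀ {A B C D} → C ⊢L A → B ⊢L D → A ⊸R B ⊢L C ⊸R D
  λ-ax  : ∀ {A} → I ⊗L A ⊢L A
  ρ-ax  : ∀ {A} → A ⊢L A ⊗L I
  α-ax  : ∀ {A B C} → (A ⊗L B) ⊗L C ⊢L A ⊗L (B ⊗L C)
  γ-ax  : ∀ {A B} → A ⊗L B ⊢L B ⊗R A
  γ⁻¹-ax : ∀ {A B} → A ⊗R B ⊢L B ⊗L A
  π     : ∀ {A B C} → A ⊗L B ⊢L C → A ⊢L B ⊸L C
  π⁻¹   : ∀ {A B C} → A ⊢L B ⊸L C → A ⊗L B ⊢L C
  πR    : ∀ {A B C} → A ⊗R B ⊢L C → A ⊢L B ⊸R C
  πR⁻¹  : ∀ {A B C} → A ⊢L B ⊸R C → A ⊗R B ⊢L C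

record FrameData : Set₁ where
  field
    W   : Set
    _≤_ : W → W → Set
    𝕀   : W → Set
    𝕃   : W → W → W → Set
    ℝ   : W → W → W → Set

record IsSkMBiCAFrame (F : FrameData) : Set where
  open FrameData F
  field
    ≤-refl  : ∀ {a} → a ≤ a
    ≤-trans : ∀ {a b c} → a ≤ b → b ≤ c → a ≤ c
    𝕀-down  : ∀ {a b} → b ≤ a → 𝕀 a → 𝕀 b
    𝕃-up₁   : ∀ {a a' b c} → a ≤ a' → 𝕃 a b c → 𝕃 a' b c
    𝕃-up₂   : ∀ {a b b' c} → b ≤ b' → 𝕃 a b c → 𝕃 a b' c
    𝕃-down₃ : ∀ {a b c c'} → c' ≤ c → 𝕃 a b c → 𝕃 a b c'
    ℝ-up₁   : ∀ {a a' b c} → a ≤ a' → ℝ a b c → ℝ a' b c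
    ℝ-up₂   : ∀ {a b b' c} → b ≤ b' → ℝ a b c → ℝ a b' c
    ℝ-down₃ : ∀ {a b c c'} → c' ≤ c → ℝ a b c → ℝ a b c'
    LR-reverse : ∀ {a b c} → 𝕃 a b c ⇔ ℝ b a c
    LSA  : ∀ {a b c d x} → 𝕃 a b x → 𝕃 x c d → ∃ λ y → 𝕃 b c y × 𝕃 a y d
    LSLU : ∀ {a b e} → 𝕀 e → 𝕃 e a b → b ≤ a
    LSRU : ∀ a → ∃ λ e → 𝕀 e × 𝕃 a e a

record IsValuation {At : Set} (F : FrameData) (v : Fma At → FrameData.W F → Set) : Set where
  open FrameData F
  field
    v-down : ∀ A {a b} → b ≤ a → v A a → v A b
    v-I    : ∀ c → v I c ⇔ 𝕀 c
    v-⊗L   : ∀ A B c → v (A ⊗L B) c ⇔ (∃ λ a → ∃ λ b → v A a × v B b × 𝕃 a b c)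
    v-⊸L   : ∀ A B c → v (A ⊸L B) c ⇔ (∀ a b → v A a → 𝕃 c a b → v B b)
    v-⊗R   : ∀ A B c → v (A ⊗R B) c ⇔ (∃ λ a → ∃ λ b → v A a × v B b × ℝ a b c)
    v-⊸R   : ∀ A B c → v (A ⊸R B) c ⇔ (∀ a b → v A a → ℝ c a b → v B b)

record IsSkMBiCAModel {At : Set} (F : FrameData) (v : Fma At → FrameData.W F → Set) : Set where
  field
    isFrame     : IsSkMBiCAFrame F
    isValuation : IsValuation F v

canonicalFrame : (At : Set) → FrameData
canonicalFrame At = record
  { W   = Fma At
  ; _≤_ = λ A B → A ⊢L B
  ; 𝕀   = λ B → B ⊢L I
  ; 𝕃   = λ A B C → C ⊢L A ⊗L B
  ; ℝ   = λ A B C → C ⊢L A ⊗R B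
  }

canonicalVal : (At : Set) → Fma At → Fma At → Set
canonicalVal At A B = B ⊢L A

{-# OPTIONS --safe #-}
-- Every frame condition is a rule or axiom of the calculus read through the
-- definitions: ≤ is id/comp, monotonicity of 𝕃 is the ⊗L rule, LSA is α with
-- witness b ⊗L c, and the unit conditions are λ and ρ with e = I. The only
-- missing structural rule, monotonicity of ⊗R, is derived by conjugating the
-- ⊗L rule with γ and γ⁻¹. For the valuation, the existential clauses are met
-- by the formulae A, B themselves, and the ⊸ clauses are the π adjunctions,
-- whose converse direction instantiates the premise at a = A, b = c ⊗ A.
module Submission where

open import Defs
open import Data.Product using (_,_)
open import Function.Bundles using (mk⇔)

module _ {At : Set} where

  ⊗R-mono : {A A' B B' : Fma At} → A ⊢L A' → B ⊢L B' → A ⊗R B ⊢L A' ⊗R B'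
  ⊗R-mono p q = comp γ⁻¹-ax (comp (⊗L-r q p) γ-ax)

  ⊸L-elim : {A B C D E : Fma At} → C ⊢L A ⊸L B → D ⊢L A → E ⊢L C ⊗L D → E ⊢L B
  ⊸L-elim f p q = comp q (comp (⊗L-r id p) (π⁻¹ f))

  ⊸R-elim : {A B C D E : Fma At} → C ⊢L A ⊸R B → D ⊢L A → E ⊢L C ⊗R D → E ⊢L B
  ⊸R-elim f p q = comp q (comp (⊗R-mono id p) (πR⁻¹ f))

  canonicalFrame-isSkMBiCAFrame : IsSkMBiCAFrame (canonicalFrame At)
  canonicalFrame-isSkMBiCAFrame = record
    { ≤-refl     = id
    ; ≤-trans    = comp
    ; 𝕀-down     = comp
    ; 𝕃-up₁      = λ p h → comp h (⊗L-r p id)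
    ; 𝕃-up₂      = λ p h → comp h (⊗L-r id p)
    ; 𝕃-down₃    = comp
    ; ℝ-up₁      = λ p h → comp h (⊗R-mono p id)
    ; ℝ-up₂      = λ p h → comp h (⊗R-mono id p)
    ; ℝ-down₃    = comp
    ; LR-reverse = mk⇔ (λ h → comp h γ-ax) (λ h → comp h γ⁻¹-ax)
    ; LSA        = λ {_} {b} {c} h k → b ⊗L c , id , comp k (comp (⊗L-r h id) α-ax)
    ; LSLU       = λ e h → comp h (comp (⊗L-r e id) λ-ax)
    ; LSRU       = λ _ → I , id , ρ-ax
    }

  canonicalVal-isValuation : IsValuation (canonicalFrame At) (canonicalVal At)
  canonicalVal-isValuation = record
    { v-down = λ _ → comp
    ; v-I    = λ _ → mk⇔ (λ h → h) (λ h → h)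
    ; v-⊗L   = λ A B _ → mk⇔ (λ h → A , B , id , id , h)
                             (λ { (_ , _ , p , q , h) → comp h (⊗L-r p q) })
    ; v-⊸L   = λ A _ c → mk⇔ (λ f _ _ → ⊸L-elim f)
                             (λ g → π (g A (c ⊗L A) id id))
    ; v-⊗R   = λ A B _ → mk⇔ (λ h → A , B , id , id , h)
                             (λ { (_ , _ , p , q , h) → comp h (⊗R-mono p q) })
    ; v-⊸R   = λ A _ c → mk⇔ (λ f _ _ → ⊸R-elim f)
                             (λ g → πR (g A (c ⊗R A) id id))
    }

mainTheorem8 : (At : Set) → IsSkMBiCAModel (canonicalFrame At) (canonicalVal At)
mainTheorem8 At = record
  { isFrame     = canonicalFrame-isSkMBiCAFrame
  ; isValuation = canonicalVal-isValuation
  }
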